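{- Let $n\ge4$ and let $\Gamma$ be a simple connected graph on vertex set $\{2,\dots,n\}$, viewed as a subgraph of the complete graph $K_{n-1}$ on the same vertices. The restriction map $\pi_\Gamma: F\mapsto F\cap E(\Gamma)$ is injective on the set of $\Gamma$-stable flats of $K_{n-1}$ (equivalently, on the cones corresponding to $\Gamma$-stable flats) if and only if $\operatorname{rk}(F)=\operatorname{rk}(F\cap E(\Gamma))$ for every $\Gamma$-stable flat $F$ of $K_{n-1}$.
   Context: Cycle matroid of a graph: ground set the edges, independent sets the forests; the rank of an edge set is the number of edges of a spanning forest of it (= number of non-isolated vertices minus number of connected components among them). Flats: edge sets $F$ such that adding any edge outside $F$ increases the rank. The flats of $K_{n-1}$ are exactly the edge sets of cluster graphs $\coprod_{j=1}^d K_{I_j}$, with $I_j\subseteq\{2,\dots,n\}$ pairwise disjoint of size $\ge2$ and $K_I$ the complete graph on $I$. Such a flat is $\Gamma$-stable if each $K_{I_j}$ contains at least one edge of $\Gamma$ (equivalently, the tropical curve with a root vertex carrying end $1$ and the labels outside $\bigcup I_j$, joined by $d$ bounded edges to vertices $v_j$ carrying ends labeled $I_j$, is $\Gamma$-stable: every non-root vertex with a single bounded edge has two of its end labels joined by an edge of $\Gamma$). The map $\pi_\Gamma$ is the projection $\mathbb{R}^{|E(K_{n-1})|}/L\to\mathbb{R}^{|E(K_{n-1})|}/L/\mathrm{span}\{v_e:e\notin E(\Gamma)\}$, $L=\mathbb{R}(1,\dots,1)$, which on flats acts as $F\mapsto F\cap E(\Gamma)$. -}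

module Defs where

open import Data.Nat using (ℕ; zero; suc; _∸_; _>_)
open import Data.Fin using (Fin; _<_; _<?_)
open import Data.Fin.Properties using (_≟_)
open import Data.Bool using (Bool; true; false; _∧_; _∨_; not; if_then_else_)
open import Data.List using (allFin; map)
open import Data.Bool.ListAction using (any)
open import Data.Nat.ListAction using (sum)
open import Data.Product using (Σ; _×_; ∃-syntax)
open import Relation.Nullary using (yes; no)
open import Relation.Nullary.Decidable using (⌊_⌋)
open import Relation.Binary.PropositionalEquality using (_≡_)

-- Vertices {2,…,n} are encoded as Fin m with m = n - 1 (vertex i ↦ label i+2).
-- An edge set of K_m is a Bool-valued function; only the entries (i , j) with
-- i < j are meaningful (they encode the edge {i,j}); other entries are ignored.
EdgeSet : ℕ → Set
EdgeSet m = Fin m → Fin m → Bool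

module _ {m : ℕ} where

  adj : EdgeSet m → Fin m → Fin m → Bool
  adj F u v with u <? v | v <? u
  ... | yes _ | _     = F u v
  ... | no _  | yes _ = F v u
  ... | no _  | no _  = false

  anyV : (Fin m → Bool) → Bool
  anyV p = any p (allFin m)

  countV : (Fin m → Bool) → ℕ
  countV p = sum (map (λ v → if p v then 1 else 0) (allFin m))

  reach : ℕ → EdgeSet m → Fin m → Fin m → Bool
  reach zero    F u v = ⌊ u ≟ v ⌋
  reach (suc k) F u v = reach k F u v ∨ anyV (λ w → reach k F u w ∧ adj F w v)

  connected : EdgeSet m → Fin m → Fin m → Bool
  connected F u v = reach m F u v

  nonIsolated : EdgeSet m → Fin m → Bool
  nonIsolated F v = anyV (adj F v)

  -- rank in the cycle matroid of K_m:
  -- (# non-isolated vertices) - (# connected components among them);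
  -- each such component is counted once, via its least vertex.
  rank : EdgeSet m → ℕ
  rank F = countV (nonIsolated F)
         ∸ countV (λ v → nonIsolated F v ∧ not (anyV (λ u → ⌊ u <? v ⌋ ∧ connected F u v)))

  insertE : EdgeSet m → Fin m → Fin m → EdgeSet m
  insertE F i j a b = F a b ∨ (⌊ a ≟ i ⌋ ∧ ⌊ b ≟ j ⌋)

  interE : EdgeSet m → EdgeSet m → EdgeSet m
  interE F G a b = F a b ∧ G a b

  _≈E_ : EdgeSet m → EdgeSet m → Set
  F ≈E G = ∀ i j → i < j → F i j ≡ G i j

  IsFlat : EdgeSet m → Set
  IsFlat F = ∀ i j → i < j → F i j ≡ false → rank (insertE F i j) > rank F

  -- Γ-stable: every connected component of F (a clique K_{I_j} when F is a flat)
  -- contains an edge of Γ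
  IsStable : EdgeSet m → EdgeSet m → Set
  IsStable Γ F = ∀ i j → i < j → F i j ≡ true →
    ∃[ a ] ∃[ b ] (a < b × Γ a b ≡ true × connected F i a ≡ true × connected F i b ≡ true)

  StableFlat : EdgeSet m → EdgeSet m → Set
  StableFlat Γ F = IsFlat F × IsStable Γ F

  PiInjectiveOnStableFlats : EdgeSet m → Set
  PiInjectiveOnStableFlats Γ = ∀ F G → StableFlat Γ F → StableFlat Γ G →
    interE F Γ ≈E interE G Γ → F ≈E G

  ConnectedGraph : EdgeSet m → Set
  ConnectedGraph Γ = ∀ u v → connected Γ u v ≡ true

-- Everything is phrased through the partition of the vertices into connected components.
-- Call a vertex a root of E when it is the least vertex of its component; then
-- rank E = #(non-roots of E), and a flat is exactly a "closed" edge set, i.e. one that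
-- contains every edge {i,j} whose endpoints it connects.  For H = F ∩ Γ ⊆ F the
-- components of H refine those of F, so rank H = rank F iff F and H have the same
-- components.
--
-- (⇐) Let F, G be stable flats with F ∩ Γ = G ∩ Γ, and rank F = rank (F ∩ Γ).  Every edge
--     of F joins two vertices connected in F ∩ Γ = G ∩ Γ ⊆ G, hence is an edge of the
--     closed set G; by symmetry F = G.
-- (⇒) If rank F ≠ rank (F ∩ Γ), some component of F splits into several components of
--     F ∩ Γ.  Cutting F along one of them (keeping only the edges inside or outside it)
--     gives a different Γ-stable flat with the same trace on Γ.
module Submission where

open import Defs
open import Data.Nat as N using (ℕ; zero; suc; _≤_; _∸_; _+_; z≤n; s≤s; _≤′_; ≤′-refl; ≤′-step)
open import Data.Nat.Properties
  using (+-suc; m≤n⇒m≤1+n; n≤1+n; m≤n+m; +-monoˡ-≤; ≤-trans; <⇒≱; <-irrefl; ≤-antisym; m+n∸m≡n; ≤⇒≤′)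
open import Data.Fin using (Fin; _<_; _<?_)
open import Data.Fin.Properties as FinP using (_≟_; <-cmp)
open import Data.Fin.Induction using (<-wellFounded)
open import Data.Bool using (Bool; true; false; _∧_; _∨_; not; if_then_else_)
open import Data.Bool.Properties using (T-≡; ¬-not) renaming (_≟_ to _≟ᴮ_)
open import Data.List using (List; []; _∷_; allFin; map; length)
open import Data.List.Properties using (length-tabulate)
open import Data.Nat.ListAction using (sum)
open import Data.List.Relation.Unary.Any using (here; there; satisfied)
open import Data.List.Relation.Unary.Any.Properties using (any⁺; any⁻)
open import Data.List.Membership.Propositional using (_∈_; lose)
open import Data.List.Membership.Propositional.Properties using (∈-allFin)
open import Data.Product using (_×_; _,_; proj₁; proj₂; ∃-syntax)
open import Data.Sum using (_⊎_; inj₁; inj₂)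
open import Data.Empty using (⊥; ⊥-elim)
open import Function.Bundles using (Equivalence)
open import Induction.WellFounded using (Acc; acc)
open import Relation.Nullary using (Dec; yes; no; ¬_)
open import Relation.Nullary.Decidable using (⌊_⌋)
open import Relation.Binary.PropositionalEquality using (_≡_; _≢_; refl; sym; trans; cong; subst)
open import Relation.Binary.Definitions using (tri<; tri≈; tri>)

not-both : ∀ {b} → b ≡ true → b ≡ false → ⊥
not-both refl ()

∨-elim : ∀ {a b} → a ∨ b ≡ true → a ≡ true ⊎ b ≡ true
∨-elim {true}  _ = inj₁ refl
∨-elim {false} e = inj₂ e

∨-introˡ : ∀ {a} b → a ≡ true → a ∨ b ≡ true
∨-introˡ b refl = refl

∨-introʳ : ∀ a {b} → b ≡ true → a ∨ b ≡ true
∨-introʳ true  _ = refl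
∨-introʳ false e = e

∧-elim : ∀ {a b} → a ∧ b ≡ true → a ≡ true × b ≡ true
∧-elim {true} {true} _ = refl , refl

∧-intro : ∀ {a b} → a ≡ true → b ≡ true → a ∧ b ≡ true
∧-intro refl refl = refl

not-elim : ∀ {b} → not b ≡ true → b ≡ false
not-elim {false} _ = refl

bool-ext : ∀ {a b} → (a ≡ true → b ≡ true) → (b ≡ true → a ≡ true) → a ≡ b
bool-ext {true}           a⇒b _   = sym (a⇒b refl)
bool-ext {false} {true}   _   b⇒a = b⇒a refl
bool-ext {false} {false}  _   _   = refl

dec-sound : ∀ {P : Set} (d : Dec P) → ⌊ d ⌋ ≡ true → P
dec-sound (yes p) _ = p

dec-complete : ∀ {P : Set} (d : Dec P) → P → ⌊ d ⌋ ≡ true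
dec-complete (yes _)  _ = refl
dec-complete (no ¬p) p = ⊥-elim (¬p p)

_⊆ᵇ_ : ∀ {A : Set} → (A → Bool) → (A → Bool) → Set
p ⊆ᵇ q = ∀ x → p x ≡ true → q x ≡ true

count : ∀ {A : Set} → (A → Bool) → List A → ℕ
count p xs = sum (map (λ v → if p v then 1 else 0) xs)

module _ {A : Set} where

  count-split : (p q : A → Bool) (xs : List A) → q ⊆ᵇ p →
                count p xs ≡ count (λ v → p v ∧ not (q v)) xs + count q xs
  count-split p q [] q⊆p = refl
  count-split p q (x ∷ xs) q⊆p with p x in px | q x in qx
  ... | true  | true  = trans (cong suc (count-split p q xs q⊆p)) (sym (+-suc _ _))
  ... | true  | false = cong suc (count-split p q xs q⊆p)
  ... | false | true  = ⊥-elim (not-both (q⊆p x qx) px)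
  ... | false | false = count-split p q xs q⊆p

  count-pos : (p : A → Bool) {x : A} {xs : List A} → x ∈ xs → p x ≡ true → 1 ≤ count p xs
  count-pos p (here refl) px rewrite px = s≤s z≤n
  count-pos p {xs = y ∷ xs} (there x∈xs) px = ≤-trans (count-pos p x∈xs px) (m≤n+m _ _)

  count-mono : (p q : A → Bool) (xs : List A) → p ⊆ᵇ q → count p xs ≤ count q xs
  count-mono p q xs p⊆q rewrite count-split q p xs p⊆q = m≤n+m _ _

  count-strict : (p q : A → Bool) (xs : List A) → p ⊆ᵇ q → ∀ {x} → x ∈ xs →
                 q x ≡ true → p x ≡ false → suc (count p xs) ≤ count q xs
  count-strict p q xs p⊆q x∈xs qx px rewrite count-split q p xs p⊆q =
    +-monoˡ-≤ (count p xs) (count-pos _ x∈xs (∧-intro qx (cong not px)))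

  count-≤-length : (p : A → Bool) (xs : List A) → count p xs ≤ length xs
  count-≤-length p [] = z≤n
  count-≤-length p (x ∷ xs) with p x
  ... | true  = s≤s (count-≤-length p xs)
  ... | false = m≤n⇒m≤1+n (count-≤-length p xs)

module _ {m : ℕ} where

  anyV-intro : (p : Fin m → Bool) (x : Fin m) → p x ≡ true → anyV p ≡ true
  anyV-intro p x px =
    Equivalence.to T-≡ (any⁺ p (lose (∈-allFin x) (Equivalence.from T-≡ px)))

  anyV-witness : (p : Fin m → Bool) → anyV p ≡ true → ∃[ x ] p x ≡ true
  anyV-witness p e with satisfied (any⁻ p (allFin m) (Equivalence.from T-≡ e))
  ... | x , px = x , Equivalence.to T-≡ px

  anyV-false : (p : Fin m → Bool) → anyV p ≡ false → ∀ x → p x ≡ false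
  anyV-false p none x with p x in px
  ... | true  = ⊥-elim (not-both (anyV-intro p x px) none)
  ... | false = refl

  countV-pos : (p : Fin m → Bool) (x : Fin m) → p x ≡ true → 1 ≤ countV p
  countV-pos p x = count-pos p (∈-allFin x)

  countV-mono : (p q : Fin m → Bool) → p ⊆ᵇ q → countV p ≤ countV q
  countV-mono p q = count-mono p q (allFin m)

  countV-strict : (p q : Fin m → Bool) → p ⊆ᵇ q → (x : Fin m) →
                  q x ≡ true → p x ≡ false → suc (countV p) ≤ countV q
  countV-strict p q p⊆q x = count-strict p q (allFin m) p⊆q (∈-allFin x)

  countV-≤ : (p : Fin m → Bool) → countV p ≤ m
  countV-≤ p = subst (countV p ≤_) (length-tabulate {n = m} (λ x → x)) (count-≤-length p (allFin m))

  countV-eq⇒⊇ : (p q : Fin m → Bool) → p ⊆ᵇ q → countV p ≡ countV q → q ⊆ᵇ p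
  countV-eq⇒⊇ p q p⊆q eq x qx with p x in px
  ... | true  = refl
  ... | false = ⊥-elim (<-irrefl eq (countV-strict p q p⊆q x qx px))

  adj-< : (E : EdgeSet m) {u v : Fin m} → u < v → adj E u v ≡ E u v
  adj-< E {u} {v} u<v with u <? v
  ... | yes _   = refl
  ... | no u≮v  = ⊥-elim (u≮v u<v)

  adj-> : (E : EdgeSet m) {u v : Fin m} → v < u → adj E u v ≡ E v u
  adj-> E {u} {v} v<u with u <? v | v <? u
  ... | yes u<v | _      = ⊥-elim (FinP.<-asym u<v v<u)
  ... | no _    | yes _  = refl
  ... | no _    | no v≮u = ⊥-elim (v≮u v<u)

  adj-irrefl : (E : EdgeSet m) (u : Fin m) → adj E u u ≡ false
  adj-irrefl E u with u <? u
  ... | yes u<u = ⊥-elim (FinP.<-irrefl refl u<u)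
  ... | no _    = refl

  adj-sym : (E : EdgeSet m) (u v : Fin m) → adj E u v ≡ adj E v u
  adj-sym E u v with <-cmp u v
  ... | tri< u<v _ _    = trans (adj-< E u<v) (sym (adj-> E u<v))
  ... | tri≈ _ refl _   = refl
  ... | tri> _ _ v<u    = trans (adj-> E v<u) (sym (adj-< E v<u))

  adj-cases : (E : EdgeSet m) (u v : Fin m) → adj E u v ≡ true →
              (u < v × E u v ≡ true) ⊎ (v < u × E v u ≡ true)
  adj-cases E u v e with <-cmp u v
  ... | tri< u<v _ _  = inj₁ (u<v , trans (sym (adj-< E u<v)) e)
  ... | tri≈ _ refl _ = ⊥-elim (not-both e (adj-irrefl E u))
  ... | tri> _ _ v<u  = inj₂ (v<u , trans (sym (adj-> E v<u)) e)

  _⊆E_ : EdgeSet m → EdgeSet m → Set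
  E ⊆E E' = ∀ i j → i < j → E i j ≡ true → E' i j ≡ true

  ≈E⇒⊆E : {E E' : EdgeSet m} → E ≈E E' → E ⊆E E'
  ≈E⇒⊆E E≈E' i j i<j e = trans (sym (E≈E' i j i<j)) e

  interE⊆E : (F Γ : EdgeSet m) → interE F Γ ⊆E F
  interE⊆E F Γ i j _ e = proj₁ (∧-elim e)

  adj⇒nonIsolated : (E : EdgeSet m) (a b : Fin m) → adj E a b ≡ true → nonIsolated E b ≡ true
  adj⇒nonIsolated E a b e = anyV-intro (adj E b) a (trans (adj-sym E b a) e)

  reach-suc : (E : EdgeSet m) (k : ℕ) (u v : Fin m) → reach k E u v ≡ true → reach (suc k) E u v ≡ true
  reach-suc E k u v = ∨-introˡ _

  reach-step : (E : EdgeSet m) (k : ℕ) (u a b : Fin m) →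
               reach k E u a ≡ true → adj E a b ≡ true → reach (suc k) E u b ≡ true
  reach-step E k u a b ua ab = ∨-introʳ (reach k E u b) (anyV-intro _ a (∧-intro ua ab))

  reach-mono : (E : EdgeSet m) {k l : ℕ} → k ≤′ l → (u v : Fin m) →
               reach k E u v ≡ true → reach l E u v ≡ true
  reach-mono E ≤′-refl          u v e = e
  reach-mono E (≤′-step {l} k≤l) u v e = reach-suc E l u v (reach-mono E k≤l u v e)

  reach-ind : (E : EdgeSet m) (P : Fin m → Set) {u : Fin m} → P u →
              (∀ a b → P a → adj E a b ≡ true → P b) →
              ∀ k v → reach k E u v ≡ true → P v
  reach-ind E P {u} Pu step zero v e = subst P (dec-sound (u ≟ v) e) Pu
  reach-ind E P {u} Pu step (suc k) v e with ∨-elim e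
  ... | inj₁ short = reach-ind E P Pu step k v short
  ... | inj₂ long with anyV-witness _ long
  ...   | w , uwv = step w v (reach-ind E P Pu step k w (proj₁ (∧-elim uwv))) (proj₂ (∧-elim uwv))

  -- The reachable sets from u grow with k until they saturate, which happens by step m
  -- because each strict growth adds one of the m vertices.
  module Saturation (E : EdgeSet m) (u : Fin m) where

    Saturated : ℕ → Set
    Saturated j = ∀ v → reach (suc j) E u v ≡ true → reach j E u v ≡ true

    New : ℕ → Fin m → Bool
    New k v = reach (suc k) E u v ∧ not (reach k E u v)

    grows-or-saturated : ∀ k → Saturated k ⊎ suc (countV (reach k E u)) ≤ countV (reach (suc k) E u)
    grows-or-saturated k with anyV (New k) in new
    ... | true with anyV-witness (New k) new
    ...   | v , fresh = inj₂ (countV-strict (reach k E u) (reach (suc k) E u) (reach-suc E k u) v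
                                (proj₁ (∧-elim fresh)) (not-elim (proj₂ (∧-elim fresh))))
    grows-or-saturated k | false = inj₁ saturated
      where
      saturated : Saturated k
      saturated v later = settle later (anyV-false (New k) new v)
        where
        settle : ∀ {a b} → a ≡ true → a ∧ not b ≡ false → b ≡ true
        settle {b = true}  _    _  = refl
        settle {b = false} refl ()

    growth : ∀ k → (∃[ j ] j ≤ k × Saturated j) ⊎ suc k ≤ countV (reach k E u)
    growth zero = inj₂ (countV-pos (reach zero E u) u (dec-complete (u ≟ u) refl))
    growth (suc k) with growth k
    ... | inj₁ (j , j≤k , sat) = inj₁ (j , m≤n⇒m≤1+n j≤k , sat)
    ... | inj₂ k<#k with grows-or-saturated k
    ...   | inj₁ sat     = inj₁ (k , n≤1+n k , sat)
    ...   | inj₂ #k<#k+1 = inj₂ (≤-trans (s≤s k<#k) #k<#k+1)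

    saturates : ∃[ j ] j ≤ m × Saturated j
    saturates with growth m
    ... | inj₁ sat  = sat
    ... | inj₂ m<#m = ⊥-elim (<⇒≱ m<#m (countV-≤ (reach m E u)))

  reach⇒connected : (E : EdgeSet m) (k : ℕ) (u v : Fin m) → reach k E u v ≡ true → connected E u v ≡ true
  reach⇒connected E k u v e with Saturation.saturates E u
  ... | j , j≤m , sat = reach-mono E (≤⇒≤′ j≤m) u v
          (reach-ind E (λ x → reach j E u x ≡ true) reach-u closed k v e)
    where
    reach-u : reach j E u u ≡ true
    reach-u = reach-mono E {l = j} (≤⇒≤′ z≤n) u u (dec-complete (u ≟ u) refl)
    closed : ∀ a b → reach j E u a ≡ true → adj E a b ≡ true → reach j E u b ≡ true
    closed a b ua ab = sat b (reach-step E j u a b ua ab)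

  conn-ind : (E : EdgeSet m) (P : Fin m → Set) {u : Fin m} → P u →
             (∀ a b → P a → adj E a b ≡ true → P b) →
             ∀ v → connected E u v ≡ true → P v
  conn-ind E P Pu step = reach-ind E P Pu step m

  conn-refl : (E : EdgeSet m) (u : Fin m) → connected E u u ≡ true
  conn-refl E u = reach⇒connected E zero u u (dec-complete (u ≟ u) refl)

  conn-step : (E : EdgeSet m) (u a b : Fin m) →
              connected E u a ≡ true → adj E a b ≡ true → connected E u b ≡ true
  conn-step E u a b ua ab = reach⇒connected E (suc m) u b (reach-step E m u a b ua ab)

  conn-edge : (E : EdgeSet m) (a b : Fin m) → adj E a b ≡ true → connected E a b ≡ true
  conn-edge E a b = conn-step E a a b (conn-refl E a)

  conn-trans : (E : EdgeSet m) (u w v : Fin m) →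
               connected E u w ≡ true → connected E w v ≡ true → connected E u v ≡ true
  conn-trans E u w v uw = conn-ind E (λ x → connected E u x ≡ true) uw (λ a b → conn-step E u a b) v

  conn-sym : (E : EdgeSet m) (u v : Fin m) → connected E u v ≡ true → connected E v u ≡ true
  conn-sym E u = conn-ind E (λ x → connected E x u ≡ true) (conn-refl E u)
    (λ a b au ab → conn-trans E b a u (conn-edge E b a (trans (adj-sym E b a) ab)) au)

  _⊆C_ : EdgeSet m → EdgeSet m → Set
  E ⊆C E' = ∀ a b → connected E a b ≡ true → connected E' a b ≡ true

  edges⇒⊆C : (E E' : EdgeSet m) → (∀ i j → i < j → E i j ≡ true → connected E' i j ≡ true) → E ⊆C E'
  edges⇒⊆C E E' edge a = conn-ind E (λ x → connected E' a x ≡ true) (conn-refl E' a) step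
    where
    step : ∀ x y → connected E' a x ≡ true → adj E x y ≡ true → connected E' a y ≡ true
    step x y ax xy with adj-cases E x y xy
    ... | inj₁ (x<y , e) = conn-trans E' a x y ax (edge x y x<y e)
    ... | inj₂ (y<x , e) = conn-trans E' a x y ax (conn-sym E' y x (edge y x y<x e))

  conn-mono : (E E' : EdgeSet m) → E ⊆E E' → E ⊆C E'
  conn-mono E E' E⊆E' = edges⇒⊆C E E' λ i j i<j e →
    conn-edge E' i j (trans (adj-< E' i<j) (E⊆E' i j i<j e))

  interE⊆C : (F Γ : EdgeSet m) → interE F Γ ⊆C F
  interE⊆C F Γ = conn-mono (interE F Γ) F (interE⊆E F Γ)

  conn-nonIsolated : (E : EdgeSet m) (u v : Fin m) → u ≢ v →
                     connected E u v ≡ true → nonIsolated E v ≡ true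
  conn-nonIsolated E u v u≢v uv with conn-ind E (λ x → u ≡ x ⊎ nonIsolated E x ≡ true) (inj₁ refl)
                                       (λ a b _ ab → inj₂ (adj⇒nonIsolated E a b ab)) v uv
  ... | inj₁ u≡v  = ⊥-elim (u≢v u≡v)
  ... | inj₂ nonI = nonI

  -- Roots and rank.  A root of E is the least vertex of its connected component; the
  -- second count in the definition of rank counts exactly the non-isolated roots.

  nonRoot : EdgeSet m → Fin m → Bool
  nonRoot E v = anyV (λ u → ⌊ u <? v ⌋ ∧ connected E u v)

  nonRoot-intro : (E : EdgeSet m) (u v : Fin m) → u < v → connected E u v ≡ true → nonRoot E v ≡ true
  nonRoot-intro E u v u<v uv = anyV-intro _ u (∧-intro (dec-complete (u <? v) u<v) uv)

  nonRoot-elim : (E : EdgeSet m) (v : Fin m) → nonRoot E v ≡ true → ∃[ u ] u < v × connected E u v ≡ true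
  nonRoot-elim E v e with anyV-witness _ e
  ... | u , smaller = u , dec-sound (u <? v) (proj₁ (∧-elim smaller)) , proj₂ (∧-elim smaller)

  nonRoot⊆nonIsolated : (E : EdgeSet m) → nonRoot E ⊆ᵇ nonIsolated E
  nonRoot⊆nonIsolated E v e with nonRoot-elim E v e
  ... | u , u<v , uv = conn-nonIsolated E u v (FinP.<⇒≢ u<v) uv

  nonRoot-mono : (E E' : EdgeSet m) → E ⊆C E' → nonRoot E ⊆ᵇ nonRoot E'
  nonRoot-mono E E' E⊆E' v e with nonRoot-elim E v e
  ... | u , u<v , uv = nonRoot-intro E' u v u<v (E⊆E' u v uv)

  rank≡#nonRoot : (E : EdgeSet m) → rank E ≡ countV (nonRoot E)
  rank≡#nonRoot E =
    trans (cong (_∸ countV roots) (count-split (nonIsolated E) (nonRoot E) (allFin m) (nonRoot⊆nonIsolated E)))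
          (m+n∸m≡n (countV roots) (countV (nonRoot E)))
    where
    roots : Fin m → Bool
    roots v = nonIsolated E v ∧ not (nonRoot E v)

  rank-mono : (E E' : EdgeSet m) → E ⊆C E' → rank E ≤ rank E'
  rank-mono E E' E⊆E' rewrite rank≡#nonRoot E | rank≡#nonRoot E' =
    countV-mono (nonRoot E) (nonRoot E') (nonRoot-mono E E' E⊆E')

  root-exists : (E : EdgeSet m) (v : Fin m) → ∃[ r ] connected E r v ≡ true × nonRoot E r ≡ false
  root-exists E v = descend v (<-wellFounded v)
    where
    descend : ∀ v → Acc _<_ v → ∃[ r ] connected E r v ≡ true × nonRoot E r ≡ false
    descend v (acc smaller) with nonRoot E v in nr
    ... | false = v , conn-refl E v , nr
    ... | true with nonRoot-elim E v nr
    ...   | u , u<v , uv with descend u (smaller u<v)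
    ...     | r , ru , root = r , conn-trans E r u v ru uv , root

  roots-unique : (E : EdgeSet m) (r r' : Fin m) → nonRoot E r ≡ false → nonRoot E r' ≡ false →
                 connected E r r' ≡ true → r ≡ r'
  roots-unique E r r' root root' rr' with <-cmp r r'
  ... | tri< r<r' _ _ = ⊥-elim (not-both (nonRoot-intro E r r' r<r' rr') root')
  ... | tri≈ _ r≡r' _ = r≡r'
  ... | tri> _ _ r'<r = ⊥-elim (not-both (nonRoot-intro E r' r r'<r (conn-sym E r r' rr')) root)

  sameComponents⇒equalRank : (H F : EdgeSet m) → H ⊆C F → F ⊆C H → rank H ≡ rank F
  sameComponents⇒equalRank H F H⊆F F⊆H = ≤-antisym (rank-mono H F H⊆F) (rank-mono F H F⊆H)

  -- Equal counts make the roots of H roots of F; two vertices connected in F then lie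
  -- over H-roots that are F-connected F-roots, hence equal.
  equalRank⇒sameComponents : (H F : EdgeSet m) → H ⊆C F → rank H ≡ rank F → F ⊆C H
  equalRank⇒sameComponents H F H⊆F eq a b ab
    with root-exists H a | root-exists H b
  ... | ra , ra-a , rootᴴa | rb , rb-b , rootᴴb =
    conn-trans H a ra b (conn-sym H ra a ra-a) (subst (λ r → connected H r b ≡ true) (sym ra≡rb) rb-b)
    where
    F⊆ᵇH : nonRoot F ⊆ᵇ nonRoot H
    F⊆ᵇH = countV-eq⇒⊇ (nonRoot H) (nonRoot F) (nonRoot-mono H F H⊆F)
             (trans (sym (rank≡#nonRoot H)) (trans eq (rank≡#nonRoot F)))
    rootᶠ : ∀ r → nonRoot H r ≡ false → nonRoot F r ≡ false
    rootᶠ r rootᴴ = ¬-not λ nonRootᶠ → not-both (F⊆ᵇH r nonRootᶠ) rootᴴ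
    ra≡rb : ra ≡ rb
    ra≡rb = roots-unique F ra rb (rootᶠ ra rootᴴa) (rootᶠ rb rootᴴb)
              (conn-trans F ra a rb (H⊆F ra a ra-a)
                (conn-trans F a b rb ab (conn-sym F rb b (H⊆F rb b rb-b))))

  Closed : EdgeSet m → Set
  Closed F = ∀ i j → i < j → connected F i j ≡ true → F i j ≡ true

  insert-⊇ : (F : EdgeSet m) (i j : Fin m) → F ⊆E insertE F i j
  insert-⊇ F i j a b _ = ∨-introˡ _

  insert-connects : (F : EdgeSet m) (i j : Fin m) → i < j → connected (insertE F i j) i j ≡ true
  insert-connects F i j i<j = conn-edge (insertE F i j) i j
    (trans (adj-< (insertE F i j) i<j)
           (∨-introʳ (F i j) (∧-intro (dec-complete (i ≟ i) refl) (dec-complete (j ≟ j) refl))))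

  insert-⊆C : (F : EdgeSet m) (i j : Fin m) → connected F i j ≡ true → insertE F i j ⊆C F
  insert-⊆C F i j ij = edges⇒⊆C (insertE F i j) F edge
    where
    edge : ∀ a b → a < b → insertE F i j a b ≡ true → connected F a b ≡ true
    edge a b a<b e with ∨-elim e
    ... | inj₁ old = conn-edge F a b (trans (adj-< F a<b) old)
    ... | inj₂ new with dec-sound (a ≟ i) (proj₁ (∧-elim new)) | dec-sound (b ≟ j) (proj₂ (∧-elim new))
    ...   | refl | refl = ij

  -- Joining the components of two distinct roots of F turns one of them into a non-root.
  merge-increases-rank : (F F' : EdgeSet m) → F ⊆C F' → (a b : Fin m) → a ≢ b →
                         nonRoot F a ≡ false → nonRoot F b ≡ false → connected F' a b ≡ true →
                         rank F N.< rank F'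
  merge-increases-rank F F' F⊆F' a b a≢b root-a root-b ab
    rewrite rank≡#nonRoot F | rank≡#nonRoot F' with <-cmp a b
  ... | tri< a<b _ _ = countV-strict (nonRoot F) (nonRoot F') (nonRoot-mono F F' F⊆F') b
                         (nonRoot-intro F' a b a<b ab) root-b
  ... | tri≈ _ a≡b _ = ⊥-elim (a≢b a≡b)
  ... | tri> _ _ b<a = countV-strict (nonRoot F) (nonRoot F') (nonRoot-mono F F' F⊆F') a
                         (nonRoot-intro F' b a b<a (conn-sym F' a b ab)) root-a

  closed⇒flat : (F : EdgeSet m) → Closed F → IsFlat F
  closed⇒flat F closed i j i<j Fij≡false
    with root-exists F i | root-exists F j
  ... | a , ai , root-a | b , bj , root-b =
    merge-increases-rank F F' F⊆F' a b a≢b root-a root-b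
      (conn-trans F' a i b (F⊆F' a i ai)
        (conn-trans F' i j b (insert-connects F i j i<j) (F⊆F' j b (conn-sym F b j bj))))
    where
    F' : EdgeSet m
    F' = insertE F i j
    F⊆F' : F ⊆C F'
    F⊆F' = conn-mono F F' (insert-⊇ F i j)
    a≢b : a ≢ b
    a≢b refl = not-both (closed i j i<j (conn-trans F i a j (conn-sym F a i ai) bj)) Fij≡false

  flat⇒closed : (F : EdgeSet m) → IsFlat F → Closed F
  flat⇒closed F flat i j i<j ij with F i j in Fij
  ... | true  = refl
  ... | false = ⊥-elim (<⇒≱ (flat i j i<j Fij) (rank-mono (insertE F i j) F (insert-⊆C F i j ij)))

  -- (⇐) If rank F = rank (F ∩ Γ), every edge of F joins vertices connected in F ∩ Γ; when
  -- F ∩ Γ = G ∩ Γ for a flat G, such an edge lies in G.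
  rank-preserved⇒⊆E : (Γ F G : EdgeSet m) → IsFlat G → rank F ≡ rank (interE F Γ) →
                       interE F Γ ≈E interE G Γ → F ⊆E G
  rank-preserved⇒⊆E Γ F G flatG rankF trace i j i<j Fij =
    flat⇒closed G flatG i j i<j
      (conn-mono (interE G Γ) G (interE⊆E G Γ) i j
        (conn-mono (interE F Γ) (interE G Γ) (≈E⇒⊆E trace) i j
          (equalRank⇒sameComponents (interE F Γ) F (interE⊆C F Γ) (sym rankF) i j
            (conn-edge F i j (trans (adj-< F i<j) Fij)))))

  backward : (Γ : EdgeSet m) → ((F : EdgeSet m) → StableFlat Γ F → rank F ≡ rank (interE F Γ)) →
             PiInjectiveOnStableFlats Γ
  backward Γ rank-preserved F G stableF stableG trace i j i<j =
    bool-ext (rank-preserved⇒⊆E Γ F G (proj₁ stableG) (rank-preserved F stableF) trace i j i<j)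
             (rank-preserved⇒⊆E Γ G F (proj₁ stableF) (rank-preserved G stableG) trace⁻¹ i j i<j)
    where
    trace⁻¹ : interE G Γ ≈E interE F Γ
    trace⁻¹ a b a<b = sym (trace a b a<b)

  ΓEdgeInComponent : EdgeSet m → EdgeSet m → Fin m → Set
  ΓEdgeInComponent Γ E a =
    ∃[ c ] ∃[ d ] (c < d × Γ c d ≡ true × connected E a c ≡ true × connected E a d ≡ true)

  refine : EdgeSet m → (Fin m → Bool) → EdgeSet m
  refine F p a b = F a b ∧ ⌊ p a ≟ᴮ p b ⌋

  module Refinement (F : EdgeSet m) (closedF : Closed F) (p : Fin m → Bool) where

    G : EdgeSet m
    G = refine F p

    refine-⊆E : G ⊆E F
    refine-⊆E i j _ e = proj₁ (∧-elim e)

    refine-p : ∀ a b → connected G a b ≡ true → p a ≡ p b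
    refine-p a = conn-ind G (λ x → p a ≡ p x) refl step
      where
      step : ∀ x y → p a ≡ p x → adj G x y ≡ true → p a ≡ p y
      step x y ax xy with adj-cases G x y xy
      ... | inj₁ (_ , e) = trans ax (dec-sound (p x ≟ᴮ p y) (proj₂ (∧-elim e)))
      ... | inj₂ (_ , e) = trans ax (sym (dec-sound (p y ≟ᴮ p x) (proj₂ (∧-elim e))))

    -- Since F is closed, vertices connected in F and agreeing on p are adjacent in G.
    refine-edge : ∀ a b → a < b → connected F a b ≡ true → p a ≡ p b → adj G a b ≡ true
    refine-edge a b a<b ab pab =
      trans (adj-< G a<b) (∧-intro (closedF a b a<b ab) (dec-complete (p a ≟ᴮ p b) pab))

    refine-connects : ∀ a b → connected F a b ≡ true → p a ≡ p b → connected G a b ≡ true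
    refine-connects a b ab pab with <-cmp a b
    ... | tri< a<b _ _  = conn-edge G a b (refine-edge a b a<b ab pab)
    ... | tri≈ _ refl _ = conn-refl G a
    ... | tri> _ _ b<a  = conn-sym G b a (conn-edge G b a (refine-edge b a b<a (conn-sym F a b ab) (sym pab)))

    refine-closed : Closed G
    refine-closed i j i<j ij =
      ∧-intro (closedF i j i<j (conn-mono G F refine-⊆E i j ij))
              (dec-complete (p i ≟ᴮ p j) (refine-p i j ij))

    refine-differs : ∀ w v → connected F w v ≡ true → p w ≢ p v → ¬ (F ≈E G)
    refine-differs w v wv pw≢pv F≈G = pw≢pv (refine-p w v (conn-mono F G (≈E⇒⊆E F≈G) w v wv))

    module _ (Γ : EdgeSet m) (respects : ∀ a b → adj (interE F Γ) a b ≡ true → p a ≡ p b) where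

      refine-trace : interE F Γ ≈E interE G Γ
      refine-trace i j i<j = bool-ext keep drop
        where
        keep : interE F Γ i j ≡ true → interE G Γ i j ≡ true
        keep e with ∧-elim {F i j} e
        ... | Fij , Γij = ∧-intro {G i j} (∧-intro {F i j} Fij pij) Γij
          where
          pij : ⌊ p i ≟ᴮ p j ⌋ ≡ true
          pij = dec-complete (p i ≟ᴮ p j) (respects i j (trans (adj-< (interE F Γ) i<j) e))
        drop : interE G Γ i j ≡ true → interE F Γ i j ≡ true
        drop e with ∧-elim {G i j} e
        ... | Gij , Γij = ∧-intro {F i j} (refine-⊆E i j i<j Gij) Γij

      refine-Γ-edge : ∀ a x → connected F a x ≡ true → p a ≡ p x → nonIsolated (interE F Γ) x ≡ true →
                      ΓEdgeInComponent Γ G a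
      refine-Γ-edge a x ax pax nonIso-x with anyV-witness (adj (interE F Γ) x) nonIso-x
      ... | y , xy = orient (adj-cases (interE F Γ) x y xy)
        where
        ax′ : connected G a x ≡ true
        ax′ = refine-connects a x ax pax
        ay′ : connected G a y ≡ true
        ay′ = refine-connects a y (conn-trans F a x y ax (interE⊆C F Γ x y (conn-edge (interE F Γ) x y xy)))
                                  (trans pax (respects x y xy))
        orient : (x < y × interE F Γ x y ≡ true) ⊎ (y < x × interE F Γ y x ≡ true) → ΓEdgeInComponent Γ G a
        orient (inj₁ (x<y , e)) = x , y , x<y , proj₂ (∧-elim {F x y} e) , ax′ , ay′
        orient (inj₂ (y<x , e)) = y , x , y<x , proj₂ (∧-elim {F y x} e) , ay′ , ax′

      refine-stable : (∀ a b → a < b → F a b ≡ true → p a ≡ p b →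
                        ∃[ x ] connected F a x ≡ true × p a ≡ p x × nonIsolated (interE F Γ) x ≡ true) →
                      IsStable Γ G
      refine-stable hub i j i<j Gij with ∧-elim {F i j} Gij
      ... | Fij , pij with hub i j i<j Fij (dec-sound (p i ≟ᴮ p j) pij)
      ...   | x , ix , pix , nonIso-x = refine-Γ-edge i x ix pix nonIso-x

  -- In a Γ-stable flat F, the component of every edge contains a vertex incident to F ∩ Γ,
  -- namely an endpoint of the Γ-edge that stability provides (it lies in the closed set F).
  stable-edge-hub : (Γ F : EdgeSet m) → StableFlat Γ F → (i j : Fin m) → i < j → F i j ≡ true →
                    ∃[ x ] connected F i x ≡ true × nonIsolated (interE F Γ) x ≡ true
  stable-edge-hub Γ F (flat , stable) i j i<j Fij with stable i j i<j Fij
  ... | a , b , a<b , Γab , ia , ib =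
    a , ia , adj⇒nonIsolated (interE F Γ) b a (trans (adj-> (interE F Γ) a<b) (∧-intro Fab Γab))
    where
    Fab : F a b ≡ true
    Fab = flat⇒closed F flat a b a<b (conn-trans F a i b (conn-sym F i a ia) ib)

  stable-hub : (Γ F : EdgeSet m) → StableFlat Γ F → (w v : Fin m) → w ≢ v → connected F w v ≡ true →
               ∃[ x ] connected F w x ≡ true × nonIsolated (interE F Γ) x ≡ true
  stable-hub Γ F stableF w v w≢v wv with <-cmp w v
  ... | tri< w<v _ _ = stable-edge-hub Γ F stableF w v w<v (flat⇒closed F (proj₁ stableF) w v w<v wv)
  ... | tri≈ _ w≡v _ = ⊥-elim (w≢v w≡v)
  ... | tri> _ _ v<w
    with stable-edge-hub Γ F stableF v w v<w (flat⇒closed F (proj₁ stableF) v w v<w (conn-sym F w v wv))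
  ...   | x , vx , nonIso-x = x , conn-trans F w v x wv vx , nonIso-x

  component-hub : (E : EdgeSet m) (s a b : Fin m) → a ≢ b →
                  connected E s a ≡ true → connected E s b ≡ true → nonIsolated E s ≡ true
  component-hub E s a b a≢b sa sb with a ≟ s
  ... | yes refl = conn-nonIsolated E b a (λ b≡a → a≢b (sym b≡a)) (conn-sym E a b sb)
  ... | no a≢s   = conn-nonIsolated E a s a≢s (conn-sym E s a sa)

  -- Let s, t lie in one component C of the Γ-stable flat F but in
  -- different components of H = F ∩ Γ, with t incident to H.  Cutting F along the
  -- H-component K of s gives a flat G ≠ F with G ∩ Γ = F ∩ Γ.  G is Γ-stable: an edge of G
  -- inside K forces s to be incident to H, the part of C outside K contains t, and the
  -- other components of G are those of F.
  cut-contradicts-injectivity : (Γ F : EdgeSet m) → PiInjectiveOnStableFlats Γ → StableFlat Γ F →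
                                (s t : Fin m) → connected F s t ≡ true → connected (interE F Γ) s t ≡ false →
                                nonIsolated (interE F Γ) t ≡ true → ⊥
  cut-contradicts-injectivity Γ F inj stableF s t st not-st nonIso-t =
    refine-differs s t st inK-s≢inK-t (inj F G stableF stableG (refine-trace Γ respects))
    where
    H : EdgeSet m
    H = interE F Γ
    closedF : Closed F
    closedF = flat⇒closed F (proj₁ stableF)
    inK : Fin m → Bool
    inK = connected H s
    open Refinement F closedF inK
    inK-s≢inK-t : inK s ≢ inK t
    inK-s≢inK-t eq = not-both (trans (sym eq) (conn-refl H s)) not-st
    respects : ∀ a b → adj H a b ≡ true → inK a ≡ inK b
    respects a b ab = bool-ext (λ sa → conn-step H s a b sa ab)
                               (λ sb → conn-step H s b a sb (trans (adj-sym H b a) ab))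
    -- if a lies outside the F-component of s, so does its whole F-component, hence outside K
    outside : ∀ a x → connected F a s ≡ false → connected F a x ≡ true → inK x ≡ false
    outside a x as ax = ¬-not λ sx →
      not-both (conn-trans F a x s ax (conn-sym F s x (interE⊆C F Γ s x sx))) as
    hub : ∀ a b → a < b → F a b ≡ true → inK a ≡ inK b →
          ∃[ x ] connected F a x ≡ true × inK a ≡ inK x × nonIsolated H x ≡ true
    hub a b a<b Fab pab with inK a in sa | connected F a s in as
    ... | true  | _     = s , interE⊆C F Γ a s (conn-sym H s a sa) , sym (conn-refl H s) ,
                          component-hub H s a b (FinP.<⇒≢ a<b) sa (sym pab)
    ... | false | true  = t , conn-trans F a s t as st , sym not-st , nonIso-t
    ... | false | false
      with stable-hub Γ F stableF a b (FinP.<⇒≢ a<b) (conn-edge F a b (trans (adj-< F a<b) Fab))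
    ...   | x , ax , nonIso-x = x , ax , sym (outside a x as ax) , nonIso-x
    stableG : StableFlat Γ G
    stableG = closed⇒flat G refine-closed , refine-stable Γ respects hub

  disconnected⇒≢ : (E : EdgeSet m) (u v : Fin m) → connected E u v ≡ false → u ≢ v
  disconnected⇒≢ E u v not-uv refl = not-both (conn-refl E u) not-uv

  isolated-alone : (E : EdgeSet m) (v x : Fin m) →
                   nonIsolated E v ≡ false → connected E v x ≡ true → v ≡ x
  isolated-alone E v x iso vx with v ≟ x
  ... | yes v≡x = v≡x
  ... | no v≢x  =
    ⊥-elim (not-both (conn-nonIsolated E x v (λ x≡v → v≢x (sym x≡v)) (conn-sym E v x vx)) iso)

  -- If w, v are connected in F but not in H = F ∩ Γ, take t = v
  -- when v is incident to H; otherwise v is alone in its H-component, and s = v together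
  -- with any vertex t of the component that is incident to H will do.
  separating-pair : (Γ F : EdgeSet m) → StableFlat Γ F → (w v : Fin m) →
                    connected F w v ≡ true → connected (interE F Γ) w v ≡ false →
                    ∃[ s ] ∃[ t ] connected F s t ≡ true × connected (interE F Γ) s t ≡ false ×
                                  nonIsolated (interE F Γ) t ≡ true
  separating-pair Γ F stableF w v wv not-wv with nonIsolated (interE F Γ) v in nonIso-v
  ... | true  = w , v , wv , not-wv , nonIso-v
  ... | false with stable-hub Γ F stableF w v (disconnected⇒≢ (interE F Γ) w v not-wv) wv
  ...   | x , wx , nonIso-x =
    v , x , conn-trans F v w x (conn-sym F w v wv) wx , ¬-not vx-absurd , nonIso-x
    where
    vx-absurd : connected (interE F Γ) v x ≢ true
    vx-absurd vx = not-both (subst (λ y → nonIsolated (interE F Γ) y ≡ true)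
                                   (sym (isolated-alone (interE F Γ) v x nonIso-v vx)) nonIso-x) nonIso-v

  forward : (Γ : EdgeSet m) → PiInjectiveOnStableFlats Γ →
            (F : EdgeSet m) → StableFlat Γ F → rank F ≡ rank (interE F Γ)
  forward Γ inj F stableF =
    sym (sameComponents⇒equalRank (interE F Γ) F (interE⊆C F Γ) F⊆H)
    where
    F⊆H : F ⊆C interE F Γ
    F⊆H w v wv = ¬-not λ not-wv →
      let (s , t , st , not-st , nonIso-t) = separating-pair Γ F stableF w v wv not-wv
      in cut-contradicts-injectivity Γ F inj stableF s t st not-st nonIso-t

proposition3p25 : (n : ℕ) → 4 ≤ n → (Γ : EdgeSet (n ∸ 1)) → ConnectedGraph Γ →
    (PiInjectiveOnStableFlats Γ →
       ((F : EdgeSet (n ∸ 1)) → StableFlat Γ F → rank F ≡ rank (interE F Γ)))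
    × (((F : EdgeSet (n ∸ 1)) → StableFlat Γ F → rank F ≡ rank (interE F Γ)) →
       PiInjectiveOnStableFlats Γ)
proposition3p25 n _ Γ _ = forward Γ , backward Γ
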